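{- $M_{\mathbf{c}}(1)=1$, $M_{\mathbf{c}}(2)=1$, and for every $n\geq 1$, \[M_{\mathbf{c}}(3n)=2M_{\mathbf{c}}(n),\qquad M_{\mathbf{c}}(3n+1)=M_{\mathbf{c}}(3n+2)=M_{\mathbf{c}}(n)+M_{\mathbf{c}}(n+1).\] Moreover, $(M_{\mathbf{c}}(n))_{n\geq 1}$ is a $3$-regular sequence.
   Context: The Cantor sequence $\mathbf{c}=c_0c_1c_2\cdots\in\{0,1\}^{\mathbb N}$ is defined by $c_0=1$ and $c_{3n}=c_{3n+2}=c_n$, $c_{3n+1}=0$ for all $n\geq 0$. For $n\ge1$, $M_{\mathbf c}(n)=\max\{\sum_{j=i}^{i+n-1}c_j\mid i\geq0\}$. An integer sequence $(w_n)$ is $3$-regular if the $\mathbb Z$-module generated by its $3$-kernel $\{(w_{3^en+r})_{n}\mid e\geq0,\ 0\le r<3^e\}$ is finitely generated. -}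

module Defs where

open import Data.Nat using (ℕ; zero; suc; _+_; _*_; _^_; _≤_; _<_)
open import Data.Integer using (ℤ) renaming (_+_ to _+ℤ_; _*_ to _*ℤ_)
open import Data.List using (List; []; _∷_; map; foldr)
open import Data.List.Relation.Unary.All using (All)
open import Data.List.Membership.Propositional using (_∈_)
open import Data.Product using (Σ; ∃; _×_; _,_; proj₁; proj₂)
open import Relation.Binary.PropositionalEquality using (_≡_)

-- The Cantor sequence is characterised by its defining recursion
-- c₀ = 1, c_{3n} = c_{3n+2} = c_n, c_{3n+1} = 0 (which determines c uniquely).
IsCantor : (ℕ → ℕ) → Set
IsCantor c = c 0 ≡ 1 × (∀ n → c (3 * n) ≡ c n × c (3 * n + 1) ≡ 0 × c (3 * n + 2) ≡ c n)

window : (ℕ → ℕ) → ℕ → ℕ → ℕ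
window c i zero = 0
window c i (suc n) = c i + window c (suc i) n

IsMaxWindow : (ℕ → ℕ) → ℕ → ℕ → Set
IsMaxWindow c n m = (∃ λ i → window c i n ≡ m) × (∀ i → window c i n ≤ m)

Seq : Set
Seq = ℕ → ℤ

InKernel : ℕ → Seq → Seq → Set
InKernel k w v = Σ ℕ λ e → Σ ℕ λ r → r < k ^ e × (∀ n → v n ≡ w (k ^ e * n + r))

InSpan : (Seq → Set) → Seq → Set
InSpan S v = Σ (List (ℤ × Seq)) λ ps →
  All (λ p → S (proj₂ p)) ps ×
  (∀ n → v n ≡ foldr (λ p acc → (proj₁ p *ℤ proj₂ p n) +ℤ acc) (ℤ.pos 0) ps)

-- k-regular: the ℤ-module generated by the k-kernel is finitely generated,
-- i.e. it has a finite list of generators gs (each lying in the module, and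
-- spanning every kernel element, hence the whole module).
IsRegular : ℕ → Seq → Set
IsRegular k w = Σ (List Seq) λ gs →
  All (InSpan (InKernel k w)) gs × (∀ v → InKernel k w v → InSpan (λ g → g ∈ gs) v)

-- Write W i k for the window sum c_i + … + c_{i+k-1} and P k = W 0 k for the prefix sums.
-- Since c_{3n} = c_{3n+2} = c_n and c_{3n+1} = 0, a window of length 3j+t starting at 3a+s
-- collapses to the sum of two windows of length j or j+1 starting at a or a+1; for s = 0
-- this gives P(3j) = 2P(j) and P(3j+1) = P(3j+2) = P(j) + P(j+1).  Hence, by strong
-- induction on k, every window of length k is at most P k, so M = P.  The only case not
-- covered by the bound for shorter windows is a pair of overlapping windows
-- W a (j+1) + W (a+1) (j+1); it is handled by the fact that c has no two adjacent ones.
-- Finally the recurrences express every kernel sequence n ↦ P(3^e n + r) as a combination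
-- of n ↦ P n and n ↦ P (n+1), which gives 3-regularity.

module Submission where

open import Defs
open import Data.Nat using (ℕ; zero; suc; _+_; _*_; _^_; _≤_; _<_; z≤n; s≤s; z<s)
open import Data.Nat.Properties
open import Data.Nat.Induction using (<-rec)
open import Data.Nat.Tactic.RingSolver using (solve-∀)
open import Data.Integer using (ℤ; -[1+_]) renaming (_+_ to _+ℤ_; _*_ to _*ℤ_; +_ to pos)
import Data.Integer.Properties as ℤ
import Data.Integer.Tactic.RingSolver as ℤ-Solver
open import Data.List using ([]; _∷_)
open import Data.List.Relation.Unary.All using ([]; _∷_)
open import Data.List.Relation.Unary.Any using (here; there)
open import Data.List.Membership.Propositional using (_∈_)
open import Data.Product using (Σ; _×_; _,_; proj₁; proj₂)
open import Data.Sum using (_⊎_; inj₁; inj₂)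
open import Relation.Binary.PropositionalEquality

data Mod3 : ℕ → Set where
  rem₀ : ∀ a → Mod3 (3 * a)
  rem₁ : ∀ a → Mod3 (suc (3 * a))
  rem₂ : ∀ a → Mod3 (suc (suc (3 * a)))

mod3 : ∀ n → Mod3 n
mod3 zero = rem₀ 0
mod3 (suc n) with mod3 n
... | rem₀ a = rem₁ a
... | rem₁ a = rem₂ a
... | rem₂ a = subst Mod3 (*-suc 3 a) (rem₀ (suc a))

1+n<3*[1+n] : ∀ n → suc n < 3 * suc n
1+n<3*[1+n] n = m<m+n (suc n) z<s

n<2+3*n : ∀ n → n < suc (suc (3 * n))
n<2+3*n n = s≤s (m≤n⇒m≤1+n (m≤m+n n _))

Bit : ℕ → Set
Bit x = x ≡ 0 ⊎ x ≡ 1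

bit-≤1 : ∀ {x} → Bit x → x ≤ 1
bit-≤1 (inj₁ refl) = z≤n
bit-≤1 (inj₂ refl) = ≤-refl

sum-≤ : ∀ {w x y p q r} → w ≡ x + y → x ≤ p → y ≤ q → r ≡ p + q → w ≤ r
sum-≤ refl x≤p y≤q refl = +-mono-≤ x≤p y≤q

window-snoc : ∀ (c : ℕ → ℕ) i k → window c i (suc k) ≡ window c i k + c (i + k)
window-snoc c i zero = trans (+-identityʳ (c i)) (cong c (sym (+-identityʳ i)))
window-snoc c i (suc k) = begin
  c i + window c (suc i) (suc k)              ≡⟨ cong (c i +_) (window-snoc c (suc i) k) ⟩
  c i + (window c (suc i) k + c (suc i + k))  ≡⟨ +-assoc (c i) _ _ ⟨
  window c i (suc k) + c (suc i + k)          ≡⟨ cong (λ m → window c i (suc k) + c m) (+-suc i k) ⟨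
  window c i (suc k) + c (i + suc k)          ∎
  where open ≡-Reasoning

window-≤-suc : ∀ (c : ℕ → ℕ) i k → window c i k ≤ window c i (suc k)
window-≤-suc c i k = subst (window c i k ≤_) (sym (window-snoc c i k)) (m≤m+n _ _)

module CantorWindows (c : ℕ → ℕ) (cantor : IsCantor c) where

  W : ℕ → ℕ → ℕ
  W = window c

  prefix : ℕ → ℕ
  prefix = W 0

  c-0 : c 0 ≡ 1
  c-0 = proj₁ cantor

  c-3n : ∀ n → c (3 * n) ≡ c n
  c-3n n = proj₁ (proj₂ cantor n)

  c-3n+1 : ∀ n → c (suc (3 * n)) ≡ 0
  c-3n+1 n = trans (cong c (+-comm 1 (3 * n))) (proj₁ (proj₂ (proj₂ cantor n)))

  c-3n+2 : ∀ n → c (suc (suc (3 * n))) ≡ c n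
  c-3n+2 n = trans (cong c (+-comm 2 (3 * n))) (proj₂ (proj₂ (proj₂ cantor n)))

  cantor-bit : ∀ i → Bit (c i)
  cantor-bit = <-rec (λ i → Bit (c i)) bit
    where
    bit : ∀ i → (∀ {j} → j < i → Bit (c j)) → Bit (c i)
    bit i rec with mod3 i
    ... | rem₀ zero    = inj₂ c-0
    ... | rem₀ (suc a) = subst Bit (sym (c-3n (suc a))) (rec (1+n<3*[1+n] a))
    ... | rem₁ a       = inj₁ (c-3n+1 a)
    ... | rem₂ a       = subst Bit (sym (c-3n+2 a)) (rec (n<2+3*n a))

  no-adjacent-ones : ∀ i → c i + c (suc i) ≤ 1
  no-adjacent-ones = <-rec (λ i → c i + c (suc i) ≤ 1) adjacent
    where
    adjacent : ∀ i → (∀ {j} → j < i → c j + c (suc j) ≤ 1) → c i + c (suc i) ≤ 1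
    adjacent i rec with mod3 i
    ... | rem₀ a = subst (_≤ 1) (sym (trans (cong₂ _+_ (c-3n a) (c-3n+1 a)) (+-identityʳ (c a))))
                         (bit-≤1 (cantor-bit a))
    ... | rem₁ a = subst (_≤ 1) (sym (cong₂ _+_ (c-3n+1 a) (c-3n+2 a))) (bit-≤1 (cantor-bit a))
    ... | rem₂ a = subst (_≤ 1) (sym (cong₂ _+_ (c-3n+2 a) (trans (cong c (sym (*-suc 3 a))) (c-3n (suc a)))))
                         (rec (n<2+3*n a))

  window-3a-3j : ∀ a j → W (3 * a) (3 * j) ≡ W a j + W a j
  window-3a-3j a zero = refl
  window-3a-3j a (suc j) = begin
    W (3 * a) (3 * suc j)
      ≡⟨ cong (W (3 * a)) (*-suc 3 j) ⟩
    c (3 * a) + (c (suc (3 * a)) + (c (suc (suc (3 * a))) + W (suc (suc (suc (3 * a)))) (3 * j)))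
      ≡⟨ cong₂ _+_ (c-3n a) (cong₂ _+_ (c-3n+1 a) (cong₂ _+_ (c-3n+2 a)
           (cong (λ i → W i (3 * j)) (sym (*-suc 3 a))))) ⟩
    c a + (c a + W (3 * suc a) (3 * j))
      ≡⟨ cong (λ x → c a + (c a + x)) (window-3a-3j (suc a) j) ⟩
    c a + (c a + (W (suc a) j + W (suc a) j))
      ≡⟨ shuffle (c a) (W (suc a) j) ⟩
    W a (suc j) + W a (suc j) ∎
    where
    open ≡-Reasoning
    shuffle : ∀ x y → x + (x + (y + y)) ≡ (x + y) + (x + y)
    shuffle = solve-∀

  window-3a-3j+1 : ∀ a j → W (3 * a) (suc (3 * j)) ≡ W a j + W a (suc j)
  window-3a-3j+1 a j = begin
    W (3 * a) (suc (3 * j))           ≡⟨ window-snoc c (3 * a) (3 * j) ⟩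
    W (3 * a) (3 * j) + c (3 * a + 3 * j)
      ≡⟨ cong₂ _+_ (window-3a-3j a j) (trans (cong c (sym (*-distribˡ-+ 3 a j))) (c-3n (a + j))) ⟩
    (W a j + W a j) + c (a + j)       ≡⟨ +-assoc (W a j) _ _ ⟩
    W a j + (W a j + c (a + j))       ≡⟨ cong (W a j +_) (window-snoc c a j) ⟨
    W a j + W a (suc j)               ∎
    where open ≡-Reasoning

  window-3a-3j+2 : ∀ a j → W (3 * a) (suc (suc (3 * j))) ≡ W a j + W a (suc j)
  window-3a-3j+2 a j = begin
    W (3 * a) (suc (suc (3 * j)))     ≡⟨ window-snoc c (3 * a) (suc (3 * j)) ⟩
    W (3 * a) (suc (3 * j)) + c (3 * a + suc (3 * j))
      ≡⟨ cong₂ _+_ (window-3a-3j+1 a j) (trans (cong c 3a+3j+1) (c-3n+1 (a + j))) ⟩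
    (W a j + W a (suc j)) + 0         ≡⟨ +-identityʳ _ ⟩
    W a j + W a (suc j)               ∎
    where
    open ≡-Reasoning
    3a+3j+1 : 3 * a + suc (3 * j) ≡ suc (3 * (a + j))
    3a+3j+1 = trans (+-suc (3 * a) (3 * j)) (cong suc (sym (*-distribˡ-+ 3 a j)))

  drop-first-digit : ∀ a m x y → W (3 * a) (suc m) ≡ x + (c a + y) → W (suc (3 * a)) m ≡ x + y
  drop-first-digit a m x y eq = +-cancelʳ-≡ (c a) _ _ (begin
    W (suc (3 * a)) m + c a           ≡⟨ +-comm _ (c a) ⟩
    c a + W (suc (3 * a)) m           ≡⟨ cong (_+ W (suc (3 * a)) m) (c-3n a) ⟨
    W (3 * a) (suc m)                 ≡⟨ eq ⟩
    x + (c a + y)                     ≡⟨ shuffle x (c a) y ⟩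
    (x + y) + c a                     ∎)
    where
    open ≡-Reasoning
    shuffle : ∀ x e y → x + (e + y) ≡ (x + y) + e
    shuffle = solve-∀

  window-3a+1-3j : ∀ a j → W (suc (3 * a)) (3 * j) ≡ W a j + W (suc a) j
  window-3a+1-3j a j = drop-first-digit a (3 * j) (W a j) (W (suc a) j) (window-3a-3j+1 a j)

  window-3a+1-3j+1 : ∀ a j → W (suc (3 * a)) (suc (3 * j)) ≡ W a j + W (suc a) j
  window-3a+1-3j+1 a j = drop-first-digit a (suc (3 * j)) (W a j) (W (suc a) j) (window-3a-3j+2 a j)

  window-3a+1-3j+2 : ∀ a j → W (suc (3 * a)) (suc (suc (3 * j))) ≡ W a (suc j) + W (suc a) j
  window-3a+1-3j+2 a j = drop-first-digit a (suc (suc (3 * j))) (W a (suc j)) (W (suc a) j)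
    (trans (cong (W (3 * a)) (sym (*-suc 3 j))) (window-3a-3j a (suc j)))

  window-3a+2 : ∀ a m → W (suc (suc (3 * a))) m ≡ W (suc (3 * a)) (suc m)
  window-3a+2 a m = sym (cong (_+ W (suc (suc (3 * a))) m) (c-3n+1 a))

  prefix-1 : prefix 1 ≡ 1
  prefix-1 = cong (_+ 0) c-0

  prefix-2 : prefix 2 ≡ 1
  prefix-2 = cong₂ _+_ c-0 (cong (_+ 0) (c-3n+1 0))

  prefix-3j : ∀ j → prefix (3 * j) ≡ prefix j + prefix j
  prefix-3j = window-3a-3j 0

  prefix-3j+1 : ∀ j → prefix (suc (3 * j)) ≡ prefix j + prefix (suc j)
  prefix-3j+1 = window-3a-3j+1 0

  prefix-3j+2 : ∀ j → prefix (suc (suc (3 * j))) ≡ prefix j + prefix (suc j)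
  prefix-3j+2 = window-3a-3j+2 0

  prefix-2+ : ∀ m → prefix (suc (suc m)) ≤ prefix m + 1
  prefix-2+ m = begin
    prefix (suc (suc m))              ≡⟨ window-snoc c 0 (suc m) ⟩
    prefix (suc m) + c (suc m)        ≡⟨ cong (_+ c (suc m)) (window-snoc c 0 m) ⟩
    (prefix m + c m) + c (suc m)      ≡⟨ +-assoc (prefix m) _ _ ⟩
    prefix m + (c m + c (suc m))      ≤⟨ +-monoʳ-≤ (prefix m) (no-adjacent-ones m) ⟩
    prefix m + 1                      ∎
    where open ≤-Reasoning

  PrefixIsMax : ℕ → Set
  PrefixIsMax k = ∀ i → W i k ≤ prefix k

  prefix-is-max-1 : PrefixIsMax 1
  prefix-is-max-1 i = subst₂ _≤_ (sym (+-identityʳ (c i))) (sym prefix-1) (bit-≤1 (cantor-bit i))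

  prefix-is-max-2 : PrefixIsMax 2
  prefix-is-max-2 i =
    subst₂ _≤_ (cong (c i +_) (sym (+-identityʳ (c (suc i))))) (sym prefix-2) (no-adjacent-ones i)

  -- The pair equals c i + 2 W (i+1) m + c (i+m+1).  If an outer digit is 0 the bounds for
  -- single windows suffice; if both are 1, the window of length m+2 starting at i together
  -- with prefix (m+2) ≤ prefix m + 1 forces W (i+1) m < prefix m.
  adjacent-windows : ∀ m → PrefixIsMax m → PrefixIsMax (suc m) → PrefixIsMax (suc (suc m)) →
    ∀ i → W i (suc m) + W (suc i) (suc m) ≤ prefix m + prefix (suc m)
  adjacent-windows m max-m max-m+1 max-m+2 i with cantor-bit i | cantor-bit (suc i + m)
  ... | inj₁ cᵢ≡0 | _ = begin
    (c i + W (suc i) m) + W (suc i) (suc m) ≡⟨ cong (λ x → (x + W (suc i) m) + W (suc i) (suc m)) cᵢ≡0 ⟩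
    W (suc i) m + W (suc i) (suc m)      ≤⟨ +-mono-≤ (max-m (suc i)) (max-m+1 (suc i)) ⟩
    prefix m + prefix (suc m)            ∎
    where open ≤-Reasoning
  ... | _ | inj₁ cₑ≡0 = begin
    W i (suc m) + W (suc i) (suc m)      ≡⟨ cong (W i (suc m) +_) (window-snoc c (suc i) m) ⟩
    W i (suc m) + (W (suc i) m + c (suc i + m)) ≡⟨ cong (λ x → W i (suc m) + (W (suc i) m + x)) cₑ≡0 ⟩
    W i (suc m) + (W (suc i) m + 0)      ≡⟨ cong (W i (suc m) +_) (+-identityʳ _) ⟩
    W i (suc m) + W (suc i) m            ≤⟨ +-mono-≤ (max-m+1 i) (max-m (suc i)) ⟩
    prefix (suc m) + prefix m            ≡⟨ +-comm (prefix (suc m)) _ ⟩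
    prefix m + prefix (suc m)            ∎
    where open ≤-Reasoning
  ... | inj₂ cᵢ≡1 | inj₂ cₑ≡1 = begin
    W i (suc m) + W (suc i) (suc m)      ≡⟨ cong₂ _+_ (cong (_+ inner) cᵢ≡1)
                                              (trans (window-snoc c (suc i) m) (cong (inner +_) cₑ≡1)) ⟩
    suc inner + (inner + 1)              ≡⟨ cong (suc inner +_) (+-comm inner 1) ⟩
    suc inner + suc inner                ≤⟨ +-mono-≤ inner<prefix inner<prefix ⟩
    prefix m + prefix m                  ≤⟨ +-monoʳ-≤ (prefix m) (window-≤-suc c 0 m) ⟩
    prefix m + prefix (suc m)            ∎
    where
    open ≤-Reasoning
    inner : ℕ
    inner = W (suc i) m
    inner<prefix : inner < prefix m
    inner<prefix = +-cancelʳ-≤ 1 (suc inner) (prefix m) (begin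
      suc inner + 1                      ≡⟨ cong suc (sym (trans (window-snoc c (suc i) m) (cong (inner +_) cₑ≡1))) ⟩
      suc (W (suc i) (suc m))            ≡⟨ cong (_+ W (suc i) (suc m)) cᵢ≡1 ⟨
      W i (suc (suc m))                  ≤⟨ max-m+2 i ⟩
      prefix (suc (suc m))               ≤⟨ prefix-2+ m ⟩
      prefix m + 1                       ∎)

  prefix-is-max-3j : ∀ {j} → PrefixIsMax j → PrefixIsMax (3 * j)
  prefix-is-max-3j {j} max-j i with mod3 i
  ... | rem₀ a = sum-≤ (window-3a-3j a j) (max-j a) (max-j a) (prefix-3j j)
  ... | rem₁ a = sum-≤ (window-3a+1-3j a j) (max-j a) (max-j (suc a)) (prefix-3j j)
  ... | rem₂ a = sum-≤ (trans (window-3a+2 a (3 * j)) (window-3a+1-3j+1 a j))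
                       (max-j a) (max-j (suc a)) (prefix-3j j)

  prefix-is-max-3j+1 : ∀ {j} → PrefixIsMax j → PrefixIsMax (suc j) → PrefixIsMax (suc (3 * j))
  prefix-is-max-3j+1 {j} max-j max-j+1 i with mod3 i
  ... | rem₀ a = sum-≤ (window-3a-3j+1 a j) (max-j a) (max-j+1 a) (prefix-3j+1 j)
  ... | rem₁ a = sum-≤ (window-3a+1-3j+1 a j) (max-j a)
                       (≤-trans (max-j (suc a)) (window-≤-suc c 0 j)) (prefix-3j+1 j)
  ... | rem₂ a = sum-≤ (trans (window-3a+2 a (suc (3 * j))) (window-3a+1-3j+2 a j))
                       (max-j+1 a) (max-j (suc a)) (trans (prefix-3j+1 j) (+-comm (prefix j) _))

  prefix-is-max-3j+2 : ∀ {j} → PrefixIsMax j → PrefixIsMax (suc j) → PrefixIsMax (suc (suc j)) →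
    PrefixIsMax (suc (suc (3 * j)))
  prefix-is-max-3j+2 {j} max-j max-j+1 max-j+2 i with mod3 i
  ... | rem₀ a = sum-≤ (window-3a-3j+2 a j) (max-j a) (max-j+1 a) (prefix-3j+2 j)
  ... | rem₁ a = sum-≤ (window-3a+1-3j+2 a j)
                       (max-j+1 a) (max-j (suc a)) (trans (prefix-3j+2 j) (+-comm (prefix j) _))
  ... | rem₂ a = subst₂ _≤_ (sym pair) (sym (prefix-3j+2 j))
                        (adjacent-windows j max-j max-j+1 max-j+2 a)
    where
    pair : W (suc (suc (3 * a))) (suc (suc (3 * j))) ≡ W a (suc j) + W (suc a) (suc j)
    pair = trans (window-3a+2 a (suc (suc (3 * j))))
                 (trans (cong (W (suc (3 * a))) (sym (*-suc 3 j))) (window-3a+1-3j a (suc j)))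

  prefix-is-max : ∀ k → PrefixIsMax k
  prefix-is-max = <-rec PrefixIsMax step
    where
    step : ∀ k → (∀ {m} → m < k → PrefixIsMax m) → PrefixIsMax k
    step k rec with mod3 k
    ... | rem₀ zero    = λ i → z≤n
    ... | rem₁ zero    = prefix-is-max-1
    ... | rem₂ zero    = prefix-is-max-2
    ... | rem₀ (suc j) = prefix-is-max-3j {suc j} (rec (1+n<3*[1+n] j))
    ... | rem₁ (suc j) = prefix-is-max-3j+1 {suc j} (rec (m<n⇒m<1+n (1+n<3*[1+n] j)))
                                            (rec (s≤s (1+n<3*[1+n] j)))
    ... | rem₂ (suc j) = prefix-is-max-3j+2 {suc j} (rec (m<n⇒m<1+n (m<n⇒m<1+n (1+n<3*[1+n] j))))
                                            (rec (m<n⇒m<1+n (s≤s (1+n<3*[1+n] j))))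
                                            (rec (s≤s (s≤s (1+n<3*[1+n] j))))

module ThreeRegular (f : ℕ → ℕ)
  (f-3n : ∀ n → f (3 * n) ≡ f n + f n)
  (f-3n+1 : ∀ n → f (suc (3 * n)) ≡ f n + f (suc n))
  (f-3n+2 : ∀ n → f (suc (suc (3 * n))) ≡ f n + f (suc n)) where

  Combination : (ℕ → ℕ) → Set
  Combination g = Σ ℕ λ α → Σ ℕ λ β → ∀ n → g n ≡ α * f n + β * f (suc n)

  combination-+ : ∀ {g h k} → Combination g → Combination h → (∀ n → k n ≡ g n + h n) → Combination k
  combination-+ {g} {h} {k} (α , β , g≡) (γ , δ , h≡) k≡ = α + γ , β + δ , λ n → begin
    k n                                            ≡⟨ k≡ n ⟩
    g n + h n                                      ≡⟨ cong₂ _+_ (g≡ n) (h≡ n) ⟩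
    (α * f n + β * f (suc n)) + (γ * f n + δ * f (suc n)) ≡⟨ collect α β γ δ (f n) (f (suc n)) ⟩
    (α + γ) * f n + (β + δ) * f (suc n)            ∎
    where
    open ≡-Reasoning
    collect : ∀ α β γ δ x y → (α * x + β * y) + (γ * x + δ * y) ≡ (α + γ) * x + (β + δ) * y
    collect = solve-∀

  split-index : ∀ x n q s → (3 * x) * n + (s + 3 * q) ≡ s + 3 * (x * n + q)
  split-index = solve-∀

  digit-bound : ∀ e q → suc (3 * q) ≤ 3 ^ suc e → q < 3 ^ e
  digit-bound e q = *-cancelˡ-< 3 q (3 ^ e)

  kernel-combination : ∀ e r → r ≤ 3 ^ e → Combination (λ n → f (3 ^ e * n + r))
  kernel-combination zero zero _ = 1 , 0 , λ n →
    trans (cong f (trans (+-identityʳ _) (*-identityˡ n))) (sym (trans (+-identityʳ _) (+-identityʳ _)))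
  kernel-combination zero (suc zero) _ = 0 , 1 , λ n →
    trans (cong f (trans (+-comm _ 1) (cong suc (*-identityˡ n)))) (sym (+-identityʳ _))
  kernel-combination zero (suc (suc r)) (s≤s ())
  kernel-combination (suc e) r r≤ with mod3 r
  ... | rem₀ q = combination-+ half half λ n →
          trans (cong f (split-index (3 ^ e) n q 0)) (f-3n (3 ^ e * n + q))
    where
    half : Combination (λ n → f (3 ^ e * n + q))
    half = kernel-combination e q (*-cancelˡ-≤ 3 r≤)
  ... | rem₁ q = combination-+ (kernel-combination e q (<⇒≤ q<)) (kernel-combination e (suc q) q<) λ n →
          trans (cong f (split-index (3 ^ e) n q 1))
                (trans (f-3n+1 (3 ^ e * n + q)) (cong (λ m → f (3 ^ e * n + q) + f m) (sym (+-suc _ q))))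
    where
    q< : q < 3 ^ e
    q< = digit-bound e q r≤
  ... | rem₂ q = combination-+ (kernel-combination e q (<⇒≤ q<)) (kernel-combination e (suc q) q<) λ n →
          trans (cong f (split-index (3 ^ e) n q 2))
                (trans (f-3n+2 (3 ^ e * n + q)) (cong (λ m → f (3 ^ e * n + q) + f m) (sym (+-suc _ q))))
    where
    q< : q < 3 ^ e
    q< = digit-bound e q (≤-trans (n≤1+n _) r≤)

  F : Seq
  F n = pos (f n)

  F-suc : Seq
  F-suc n = pos (f (suc n))

  F-in-span : InSpan (InKernel 3 F) F
  F-in-span = ((pos 1 , F) ∷ []) , ((0 , 0 , z<s , λ n → cong F (sym (trans (+-identityʳ _) (*-identityˡ n)))) ∷ [])
            , λ n → one-times (F n)
    where
    one-times : ∀ (x : ℤ) → x ≡ pos 1 *ℤ x +ℤ pos 0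
    one-times = ℤ-Solver.solve-∀

  -- f (n + 1) = f (3n + 1) − f n, and n ↦ f (3n + 1) is the kernel sequence with e = r = 1.
  F-suc-in-span : InSpan (InKernel 3 F) F-suc
  F-suc-in-span = ((pos 1 , λ n → F (3 ^ 1 * n + 1)) ∷ (-[1+ 0 ] , F) ∷ [])
                , ((1 , 1 , s≤s (s≤s z≤n) , λ n → refl)
                   ∷ (0 , 0 , z<s , λ n → cong F (sym (trans (+-identityʳ _) (*-identityˡ n)))) ∷ [])
                , λ n → trans (difference (F n) (F-suc n))
                    (cong (λ t → pos 1 *ℤ t +ℤ (-[1+ 0 ] *ℤ F n +ℤ pos 0))
                      (sym (trans (cong F (+-comm (3 * n) 1)) (trans (cong pos (f-3n+1 n)) (ℤ.pos-+ (f n) _)))))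
    where
    difference : ∀ (x y : ℤ) → y ≡ pos 1 *ℤ (x +ℤ y) +ℤ (-[1+ 0 ] *ℤ x +ℤ pos 0)
    difference = ℤ-Solver.solve-∀

  pos-combination : ∀ α x β y → pos (α * x + β * y) ≡ pos α *ℤ pos x +ℤ (pos β *ℤ pos y +ℤ pos 0)
  pos-combination α x β y = begin
    pos (α * x + β * y)                          ≡⟨ ℤ.pos-+ (α * x) (β * y) ⟩
    pos (α * x) +ℤ pos (β * y)                   ≡⟨ cong₂ _+ℤ_ (ℤ.pos-* α x) (ℤ.pos-* β y) ⟩
    pos α *ℤ pos x +ℤ pos β *ℤ pos y             ≡⟨ cong (pos α *ℤ pos x +ℤ_) (ℤ.+-identityʳ _) ⟨
    pos α *ℤ pos x +ℤ (pos β *ℤ pos y +ℤ pos 0)  ∎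
    where open ≡-Reasoning

  three-regular : IsRegular 3 F
  three-regular = (F ∷ F-suc ∷ []) , (F-in-span ∷ F-suc-in-span ∷ []) , kernel-in-span
    where
    kernel-in-span : ∀ v → InKernel 3 F v → InSpan (_∈ (F ∷ F-suc ∷ [])) v
    kernel-in-span v (e , r , r< , v≡) with kernel-combination e r (<⇒≤ r<)
    ... | α , β , f≡ = ((pos α , F) ∷ (pos β , F-suc) ∷ []) , (here refl ∷ there (here refl) ∷ [])
                     , λ n → trans (v≡ n) (trans (cong pos (f≡ n)) (pos-combination α (f n) β (f (suc n))))

corollary2p3 : (c : ℕ → ℕ) → IsCantor c →
    Σ (ℕ → ℕ) λ M →
    (∀ n → IsMaxWindow c n (M n)) ×
    M 1 ≡ 1 × M 2 ≡ 1 ×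
    (∀ n → 1 ≤ n →
    M (3 * n) ≡ 2 * M n ×
    M (3 * n + 1) ≡ M n + M (n + 1) ×
    M (3 * n + 2) ≡ M n + M (n + 1)) ×
    IsRegular 3 (λ n → pos (M n))
corollary2p3 c cantor =
    prefix
  , (λ n → (0 , refl) , prefix-is-max n)
  , prefix-1 , prefix-2
  , (λ n _ → trans (prefix-3j n) (cong (prefix n +_) (sym (+-identityʳ _)))
           , trans (cong prefix (+-comm (3 * n) 1)) (trans (prefix-3j+1 n) (next n))
           , trans (cong prefix (+-comm (3 * n) 2)) (trans (prefix-3j+2 n) (next n)))
  , ThreeRegular.three-regular prefix prefix-3j prefix-3j+1 prefix-3j+2
  where
  open CantorWindows c cantor
  next : ∀ n → prefix n + prefix (suc n) ≡ prefix n + prefix (n + 1)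
  next n = cong (λ m → prefix n + prefix m) (+-comm 1 n)
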